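{- Let $T^\sigma=(T,\sigma)$ be a signed tree. Then $\dim(T)-\operatorname{ext}(T)\le \dim(T^\sigma)\le\dim(T)$.
   Context: A signed tree is $(T,\sigma)$ with $T$ a finite tree and $\sigma:E(T)\to\{+1,-1\}$; the sign $\sigma(uv)$ of the unique $u$–$v$ path is the product of its edge signs, and the signed distance is $d_\Sigma(u,v)=\sigma(uv)d(u,v)$, $d$ the distance in $T$. For an ordered vertex set $W=(w_1,\dots,w_k)$, $r(v|W)=(d_\Sigma(v,w_1),\dots,d_\Sigma(v,w_k))$; $W$ is resolving if distinct vertices have distinct representations; $\dim(T^\sigma)$ is the minimum cardinality of a resolving set, and $\dim(T)$ is the usual metric dimension of $T$ (using $d$). A major vertex is a vertex of degree at least $3$; a leaf $u$ is a terminal vertex of a major vertex $v$ if $d(u,v)<d(u,w)$ for every other major vertex $w$; an exterior major vertex is a major vertex having at least one terminal vertex; $\operatorname{ext}(T)$ is the number of exterior major vertices of $T$. -}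

module Defs where

open import Data.Nat using (ℕ; zero; suc; _≤_; _<_; _+_)
open import Data.Bool using (Bool; true; false)
open import Data.Fin using (Fin)
open import Data.Fin.Subset using (Subset; _∈_; ∣_∣)
open import Data.List using (List; []; _∷_; length; filter; allFin)
open import Data.List.Relation.Unary.Unique.Propositional using (Unique)
open import Data.Integer using (ℤ; _◃_)
open import Data.Sign using (Sign) renaming (_*_ to _*ₛ_; + to pos)
open import Data.Product using (Σ; ∃; _×_; _,_)
open import Relation.Binary.PropositionalEquality using (_≡_; _≢_)
open import Relation.Nullary using (¬_)
open import Function.Bundles using (_⇔_)

record Graph (n : ℕ) : Set where
  field
    adj     : Fin n → Fin n → Bool
    symm    : ∀ u v → adj u v ≡ adj v u
    irrefl  : ∀ u → adj u u ≡ false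
open Graph public

module _ {n : ℕ} (G : Graph n) where

  data Walk : Fin n → Fin n → Set where
    []  : ∀ {u} → Walk u u
    _∷_ : ∀ {u v w} → adj G u v ≡ true → Walk v w → Walk u w

  len : ∀ {u v} → Walk u v → ℕ
  len []       = zero
  len (_ ∷ p)  = suc (len p)

  verts : ∀ {u v} → Walk u v → List (Fin n)
  verts {u} []      = u ∷ []
  verts {u} (_ ∷ p) = u ∷ verts p

  IsPath : ∀ {u v} → Walk u v → Set
  IsPath p = Unique (verts p)

  Connected : Set
  Connected = ∀ u v → Walk u v

  Acyclic : Set
  Acyclic = ∀ u v (p : Walk u v) → IsPath p → 2 ≤ len p → adj G v u ≡ false

  Dist : Fin n → Fin n → ℕ → Set
  Dist u v k = Σ (Walk u v) (λ p → len p ≡ k) × (∀ (q : Walk u v) → k ≤ len q)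

  degree : Fin n → ℕ
  degree v = length (filter (λ w → adj G v w Data.Bool.≟ true) (allFin n))
    where import Data.Bool

  Major : Fin n → Set
  Major v = 3 ≤ degree v

  Leaf : Fin n → Set
  Leaf v = degree v ≡ 1

  Terminal : Fin n → Fin n → Set
  Terminal u v = Leaf u × Major v ×
    (∀ w → Major w → w ≢ v → ∀ k l → Dist u v k → Dist u w l → k < l)

  ExteriorMajor : Fin n → Set
  ExteriorMajor v = Major v × ∃ (λ u → Terminal u v)

  IsExt : ℕ → Set
  IsExt e = Σ (Subset n) (λ S → ∣ S ∣ ≡ e × (∀ v → (v ∈ S) ⇔ ExteriorMajor v))

  SameRep : Subset n → Fin n → Fin n → Set
  SameRep W u v = ∀ w → w ∈ W → ∀ k → Dist u w k ⇔ Dist v w k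

  Resolving : Subset n → Set
  Resolving W = ∀ u v → SameRep W u v → u ≡ v

  IsMetricDim : ℕ → Set
  IsMetricDim k = Σ (Subset n) (λ W → Resolving W × ∣ W ∣ ≡ k)
                × (∀ W → Resolving W → k ≤ ∣ W ∣)

  record Signature : Set where
    field
      sgn  : Fin n → Fin n → Sign
      sgn-symm : ∀ u v → adj G u v ≡ true → sgn u v ≡ sgn v u
  open Signature public

  module _ (σ : Signature) where
    pathSign : ∀ {u v} → Walk u v → Sign
    pathSign []                = pos
    pathSign {u} (_∷_ {v = v} _ p) = sgn σ u v *ₛ pathSign p

    SignedDist : Fin n → Fin n → ℤ → Set
    SignedDist u v z = Σ (Walk u v) (λ p → IsPath p × z ≡ pathSign p ◃ len p)

    SameRepΣ : Subset n → Fin n → Fin n → Set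
    SameRepΣ W u v = ∀ w → w ∈ W → ∀ z → SignedDist u w z ⇔ SignedDist v w z

    ResolvingΣ : Subset n → Set
    ResolvingΣ W = ∀ u v → SameRepΣ W u v → u ≡ v

    IsSignedMetricDim : ℕ → Set
    IsSignedMetricDim k = Σ (Subset n) (λ W → ResolvingΣ W × ∣ W ∣ ≡ k)
                        × (∀ W → ResolvingΣ W → k ≤ ∣ W ∣)

record IsTree {n : ℕ} (G : Graph n) : Set where
  field
    nonempty  : 1 ≤ n
    connected : Connected G
    acyclic   : Acyclic G

module Submission where

-- Since |d_Σ(u,v)| = d(u,v), every resolving set of T also resolves T^σ.
--
-- Conversely, let W_σ resolve T^σ and add, for every exterior major vertex c, one bare leg
-- of c: a neighbour whose branch contains neither a major vertex nor a vertex of W_σ.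
-- If two distinct vertices had equal distances to the enlarged set W, walking them toward
-- each other yields a hub m with two legs whose branches avoid W.  Neither branch contains
-- a major vertex: a farthest one, c, would be exterior, and its added leg, lying in W, would
-- have to point back toward m, which puts all of W_σ into its bare branch.  So if m is major
-- it is exterior, and its own added leg is a third leg whose branch avoids W_σ; two of the
-- three edges at m carry the same sign, and the two corresponding legs then have the same
-- signed representation with respect to W_σ.  If m is not major, its neighbour toward a
-- major vertex would be a third one.  A tree without major vertices is a path, resolved by
-- one leaf.

open import Defs
open import Data.Nat using (ℕ; zero; suc; _≤_; _<_; _+_; z≤n; s≤s)
open import Data.Nat.Properties
open import Data.Product using (_×_; Σ; ∃-syntax; _,_; proj₁; proj₂)
open import Data.Sum using (_⊎_; inj₁; inj₂)
open import Data.Empty using (⊥; ⊥-elim)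
open import Data.Bool using (true; false)
import Data.Bool as Bool
open import Data.Fin as Fin using (Fin) renaming (_≟_ to _≟ᶠ_)
import Data.Fin.Properties as Finₚ
open import Data.List using (List; []; _∷_; length; filter; allFin)
open import Data.List.Relation.Unary.Any using (here; there)
import Data.List.Relation.Unary.All as All
open import Data.List.Relation.Unary.All.Properties using (all-filter; ¬Any⇒All¬)
open import Data.List.Relation.Unary.AllPairs using ([]; _∷_)
open import Data.List.Relation.Unary.Unique.Propositional using (Unique)
import Data.List.Relation.Unary.Unique.Propositional.Properties as Uniqueₚ
open import Data.List.Membership.Propositional using () renaming (_∈_ to _∈ᴸ_; _∉_ to _∉ᴸ_)
open import Data.List.Membership.Propositional.Properties using (∈-filter⁺; ∈-filter⁻; ∈-allFin; ∈-length)
open import Data.List.Relation.Binary.Subset.Propositional using () renaming (_⊆_ to _⊆ᴸ_)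
open import Data.List.Extrema.Nat using (argmax; argmax-all; f[xs]≤f[argmax])
open import Data.Fin.Subset using (Subset; ∣_∣; ⁅_⁆; _∪_; _∈_; _∉_)
import Data.Fin.Subset as Subset
open import Data.Fin.Subset.Properties using (x∈p∪q⁺; x∈⁅x⁆; ∣⁅x⁆∣≡1; ∣⊥∣≡0; _∈?_; p⊆q⇒∣p∣≤∣q∣; x∈⁅y⁆⇒x≡y)
open import Data.Vec using ([]; _∷_)
import Data.Vec as Vec
open import Data.Sign using (Sign) renaming (_*_ to _*ₛ_)
open import Data.Integer using (ℤ; _◃_)
import Data.Integer as ℤ
open import Data.Integer.Properties using (abs-◃)
open import Relation.Binary.PropositionalEquality
open import Relation.Nullary using (¬_; Dec; yes; no; contradiction)
open import Relation.Nullary.Decidable using (_×-dec_; _→-dec_; ¬?)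
open import Relation.Unary using (Pred; Decidable)
open import Level using (0ℓ)
open import Axiom.UniquenessOfIdentityProofs using (module Decidable⇒UIP)
open import Function using (_∘_)
open import Function.Bundles using (_⇔_; mk⇔; Equivalence)

∣p∪q∣≤∣p∣+∣q∣ : ∀ {m} (p q : Subset m) → ∣ p ∪ q ∣ ≤ ∣ p ∣ + ∣ q ∣
∣p∪q∣≤∣p∣+∣q∣ []          []          = z≤n
∣p∪q∣≤∣p∣+∣q∣ (true ∷ p)  (true ∷ q)  = s≤s (≤-trans (∣p∪q∣≤∣p∣+∣q∣ p q) (+-monoʳ-≤ ∣ p ∣ (n≤1+n ∣ q ∣)))
∣p∪q∣≤∣p∣+∣q∣ (true ∷ p)  (false ∷ q) = s≤s (∣p∪q∣≤∣p∣+∣q∣ p q)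
∣p∪q∣≤∣p∣+∣q∣ (false ∷ p) (true ∷ q)  = subst (suc ∣ p ∪ q ∣ ≤_) (sym (+-suc ∣ p ∣ ∣ q ∣)) (s≤s (∣p∪q∣≤∣p∣+∣q∣ p q))
∣p∪q∣≤∣p∣+∣q∣ (false ∷ p) (false ∷ q) = ∣p∪q∣≤∣p∣+∣q∣ p q

image : ∀ {m k} → (Fin m → Fin k) → Subset m → Subset k
image f []          = Subset.⊥
image f (true ∷ S)  = ⁅ f Fin.zero ⁆ ∪ image (λ v → f (Fin.suc v)) S
image f (false ∷ S) = image (λ v → f (Fin.suc v)) S

∣image∣≤ : ∀ {m k} (f : Fin m → Fin k) (S : Subset m) → ∣ image f S ∣ ≤ ∣ S ∣
∣image∣≤ {k = k} f [] = ≤-reflexive (∣⊥∣≡0 k)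
∣image∣≤ f (true ∷ S) = begin
  ∣ ⁅ f Fin.zero ⁆ ∪ image _ S ∣        ≤⟨ ∣p∪q∣≤∣p∣+∣q∣ ⁅ f Fin.zero ⁆ (image _ S) ⟩
  ∣ ⁅ f Fin.zero ⁆ ∣ + ∣ image _ S ∣    ≡⟨ cong (_+ ∣ image _ S ∣) (∣⁅x⁆∣≡1 (f Fin.zero)) ⟩
  suc ∣ image _ S ∣                     ≤⟨ s≤s (∣image∣≤ _ S) ⟩
  suc ∣ S ∣                             ∎
  where open ≤-Reasoning
∣image∣≤ f (false ∷ S) = ∣image∣≤ _ S

∈-image : ∀ {m k} (f : Fin m → Fin k) {S : Subset m} {v : Fin m} → v ∈ S → f v ∈ image f S
∈-image f {true ∷ S} {Fin.zero}  _                = x∈p∪q⁺ (inj₁ (x∈⁅x⁆ (f Fin.zero)))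
∈-image f {true ∷ S} {Fin.suc v} (Vec.there v∈S) = x∈p∪q⁺ (inj₂ (∈-image _ v∈S))
∈-image f {false ∷ S} {Fin.suc v} (Vec.there v∈S) = ∈-image _ v∈S

x∈p⇒1≤∣p∣ : ∀ {m} {x : Fin m} {p : Subset m} → x ∈ p → 1 ≤ ∣ p ∣
x∈p⇒1≤∣p∣ {x = x} {p} x∈p = subst (_≤ ∣ p ∣) (∣⁅x⁆∣≡1 x)
  (p⊆q⇒∣p∣≤∣q∣ (λ y∈⁅x⁆ → subst (_∈ p) (sym (x∈⁅y⁆⇒x≡y _ y∈⁅x⁆)) x∈p))

two-of-three-signs-equal : (s₁ s₂ s₃ : Sign) → s₁ ≡ s₂ ⊎ s₁ ≡ s₃ ⊎ s₂ ≡ s₃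
two-of-three-signs-equal Sign.- Sign.- _      = inj₁ refl
two-of-three-signs-equal Sign.+ Sign.+ _      = inj₁ refl
two-of-three-signs-equal Sign.- Sign.+ Sign.- = inj₂ (inj₁ refl)
two-of-three-signs-equal Sign.- Sign.+ Sign.+ = inj₂ (inj₂ refl)
two-of-three-signs-equal Sign.+ Sign.- Sign.- = inj₂ (inj₂ refl)
two-of-three-signs-equal Sign.+ Sign.- Sign.+ = inj₂ (inj₁ refl)

same-unique-value⇒⇔ : ∀ {A : Set} {R S : A → Set} {a b : A} →
  (∀ {k} → R k → k ≡ a) → R a → (∀ {k} → S k → k ≡ b) → S b → a ≡ b → ∀ k → R k ⇔ S k
same-unique-value⇒⇔ {R = R} {S} R⇒≡a Ra S⇒≡b Sb a≡b k =
  mk⇔ (λ Rk → subst S (sym (trans (R⇒≡a Rk) a≡b)) Sb) (λ Sk → subst R (sym (trans (S⇒≡b Sk) (sym a≡b))) Ra)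

farthest : ∀ {n} {P : Pred (Fin n) 0ℓ} → Decidable P → (f : Fin n → ℕ) → ∀ {z₀} → P z₀ →
           ∃[ z ] P z × (∀ {z'} → P z' → f z' ≤ f z)
farthest {n} P? f {z₀} pz₀ =
  argmax f z₀ xs , argmax-all f pz₀ (all-filter P? (allFin n)) ,
  λ pz' → All.lookup (f[xs]≤f[argmax] z₀ xs) (∈-filter⁺ P? (∈-allFin _) pz')
  where xs = filter P? (allFin n)

module _ {A : Set} where
  private variable
    x y z : A
    xs : List A

  ∈-tail : x ∈ᴸ y ∷ xs → x ≢ y → x ∈ᴸ xs
  ∈-tail (here x≡y) x≢y = ⊥-elim (x≢y x≡y)
  ∈-tail (there x∈xs) _ = x∈xs

  2≤length : x ∈ᴸ xs → y ∈ᴸ xs → x ≢ y → 2 ≤ length xs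
  2≤length (here refl)  y∈xs        x≢y = s≤s (∈-length (∈-tail y∈xs (x≢y ∘ sym)))
  2≤length (there x∈xs) (here refl) _   = s≤s (∈-length x∈xs)
  2≤length (there x∈xs) (there y∈xs) x≢y = m≤n⇒m≤1+n (2≤length x∈xs y∈xs x≢y)

  3≤length : x ∈ᴸ xs → y ∈ᴸ xs → z ∈ᴸ xs → x ≢ y → x ≢ z → y ≢ z → 3 ≤ length xs
  3≤length (here refl)  y∈xs         z∈xs         x≢y x≢z y≢z =
    s≤s (2≤length (∈-tail y∈xs (x≢y ∘ sym)) (∈-tail z∈xs (x≢z ∘ sym)) y≢z)
  3≤length (there x∈xs) (here refl)  z∈xs         x≢y x≢z y≢z = s≤s (2≤length x∈xs (∈-tail z∈xs (y≢z ∘ sym)) x≢z)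
  3≤length (there x∈xs) (there y∈xs) (here refl)  x≢y x≢z y≢z = s≤s (2≤length x∈xs y∈xs x≢y)
  3≤length (there x∈xs) (there y∈xs) (there z∈xs) x≢y x≢z y≢z = m≤n⇒m≤1+n (3≤length x∈xs y∈xs z∈xs x≢y x≢z y≢z)

  unique∧2≤length⇒distinct : Unique xs → 2 ≤ length xs → ∃[ x ] ∃[ y ] x ∈ᴸ xs × y ∈ᴸ xs × x ≢ y
  unique∧2≤length⇒distinct {x ∷ y ∷ _} ((x≢y All.∷ _) ∷ _) _ = x , y , here refl , there (here refl) , x≢y
  unique∧2≤length⇒distinct {_ ∷ []} _ (s≤s ())

  unique∧constant⇒length≡1 : Unique xs → x ∈ᴸ xs → (∀ {y} → y ∈ᴸ xs → y ≡ x) → length xs ≡ 1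
  unique∧constant⇒length≡1 {_ ∷ []}    _                   _ _     = refl
  unique∧constant⇒length≡1 {_ ∷ _ ∷ _} ((y≢z All.∷ _) ∷ _) _ all≡x =
    ⊥-elim (y≢z (trans (all≡x (here refl)) (sym (all≡x (there (here refl))))))

module Walks {n : ℕ} (G : Graph n) where
  open import Data.List.Membership.DecPropositional (_≟ᶠ_ {n}) using () renaming (_∈?_ to _∈ᴸ?_)

  private variable
    u v w x : Fin n

  adj-sym : adj G u v ≡ true → adj G v u ≡ true
  adj-sym {u} {v} e = trans (symm G v u) e

  adj⇒≢ : adj G u v ≡ true → u ≢ v
  adj⇒≢ {u} e refl with trans (sym e) (irrefl G u)
  ... | ()

  _++ʷ_ : Walk G u v → Walk G v w → Walk G u w
  []      ++ʷ q = q
  (e ∷ p) ++ʷ q = e ∷ (p ++ʷ q)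

  len-++ʷ : (p : Walk G u v) (q : Walk G v w) → len G (p ++ʷ q) ≡ len G p + len G q
  len-++ʷ []      q = refl
  len-++ʷ (e ∷ p) q = cong suc (len-++ʷ p q)

  ∈-verts-++ʷ⁻ : (p : Walk G u v) (q : Walk G v w) → x ∈ᴸ verts G (p ++ʷ q) → x ∈ᴸ verts G p ⊎ x ∈ᴸ verts G q
  ∈-verts-++ʷ⁻ []      q x∈q           = inj₂ x∈q
  ∈-verts-++ʷ⁻ (e ∷ p) q (here x≡u)    = inj₁ (here x≡u)
  ∈-verts-++ʷ⁻ (e ∷ p) q (there x∈p++q) with ∈-verts-++ʷ⁻ p q x∈p++q
  ... | inj₁ x∈p = inj₁ (there x∈p)
  ... | inj₂ x∈q = inj₂ x∈q

  start∈verts : (p : Walk G u v) → u ∈ᴸ verts G p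
  start∈verts []      = here refl
  start∈verts (e ∷ p) = here refl

  end∈verts : (p : Walk G u v) → v ∈ᴸ verts G p
  end∈verts []      = here refl
  end∈verts (e ∷ p) = there (end∈verts p)

  reverseʷ : Walk G u v → Walk G v u
  reverseʷ []      = []
  reverseʷ (e ∷ p) = reverseʷ p ++ʷ (adj-sym e ∷ [])

  len-reverseʷ : (p : Walk G u v) → len G (reverseʷ p) ≡ len G p
  len-reverseʷ []      = refl
  len-reverseʷ (e ∷ p) = begin
    len G (reverseʷ p ++ʷ (adj-sym e ∷ [])) ≡⟨ len-++ʷ (reverseʷ p) (adj-sym e ∷ []) ⟩
    len G (reverseʷ p) + 1                  ≡⟨ +-comm (len G (reverseʷ p)) 1 ⟩
    suc (len G (reverseʷ p))                ≡⟨ cong suc (len-reverseʷ p) ⟩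
    suc (len G p)                           ∎
    where open ≡-Reasoning

  verts-reverseʷ⊆ : (p : Walk G u v) → verts G (reverseʷ p) ⊆ᴸ verts G p
  verts-reverseʷ⊆ []      x∈ = x∈
  verts-reverseʷ⊆ (e ∷ p) x∈ with ∈-verts-++ʷ⁻ (reverseʷ p) (adj-sym e ∷ []) x∈
  ... | inj₁ x∈rev-p                = there (verts-reverseʷ⊆ p x∈rev-p)
  ... | inj₂ (here refl)            = there (start∈verts p)
  ... | inj₂ (there (here refl))    = here refl

  suffixFrom : (q : Walk G u v) → x ∈ᴸ verts G q →
    Σ (Walk G x v) λ r → len G r ≤ len G q × verts G r ⊆ᴸ verts G q × (IsPath G q → IsPath G r)
  suffixFrom []      (here refl) = [] , ≤-refl , (λ x∈ → x∈) , (λ q-path → q-path)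
  suffixFrom (e ∷ q) (here refl) = (e ∷ q) , ≤-refl , (λ x∈ → x∈) , (λ q-path → q-path)
  suffixFrom (e ∷ q) (there x∈q) with suffixFrom q x∈q
  ... | r , r≤q , r⊆q , r-path = r , m≤n⇒m≤1+n r≤q , there ∘ r⊆q , λ { (_ ∷ q-path) → r-path q-path }

  ShorterPath : (p : Walk G u v) → Set
  ShorterPath {u} {v} p = Σ (Walk G u v) λ q → IsPath G q × len G q ≤ len G p × verts G q ⊆ᴸ verts G p

  toPath : (p : Walk G u v) → ShorterPath p
  toPath []      = [] , (All.[] ∷ []) , ≤-refl , (λ x∈ → x∈)
  toPath {u} (e ∷ p) with toPath p
  ... | q , q-path , q≤p , q⊆p with u ∈ᴸ? verts G q
  ...   | yes u∈q = let r , r≤q , r⊆q , r-path = suffixFrom q u∈q in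
                    r , r-path q-path , m≤n⇒m≤1+n (≤-trans r≤q q≤p) , there ∘ q⊆p ∘ r⊆q
  ...   | no u∉q  = (e ∷ q) , (¬Any⇒All¬ (verts G q) u∉q ∷ q-path) , s≤s q≤p ,
                    λ { (here t≡u) → here t≡u ; (there t∈q) → there (q⊆p t∈q) }

module Tree {n : ℕ} (G : Graph n) (tree : IsTree G) where
  open IsTree tree
  open Walks G
  open import Data.List.Membership.DecPropositional (_≟ᶠ_ {n}) using () renaming (_∈?_ to _∈ᴸ?_)
  module Bool-UIP = Decidable⇒UIP Bool._≟_

  private variable
    a b c ℓ m p t u v w w₀ x y z M : Fin n

  ≢⇒1≤len : u ≢ v → (p : Walk G u v) → 1 ≤ len G p
  ≢⇒1≤len u≢u []      = ⊥-elim (u≢u refl)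
  ≢⇒1≤len _   (e ∷ p) = s≤s z≤n

  paths-unique : (p q : Walk G u v) → IsPath G p → IsPath G q → p ≡ q
  paths-unique []      []      _ _ = refl
  paths-unique []      (e ∷ q) _ (u∉q ∷ _) = ⊥-elim (All.lookup u∉q (end∈verts q) refl)
  paths-unique (e ∷ p) []      (u∉p ∷ _) _ = ⊥-elim (All.lookup u∉p (end∈verts p) refl)
  paths-unique {u} (_∷_ {v = a} e p) (_∷_ {v = b} e' q) (u∉p ∷ p-path) (u∉q ∷ q-path) with a ≟ᶠ b
  ... | yes refl = cong₂ _∷_ (Bool-UIP.≡-irrelevant e e') (paths-unique p q p-path q-path)
  ... | no a≢b with toPath (p ++ʷ reverseʷ q)
  ...   | r , r-path , _ , r⊆ = contradiction (trans (sym (adj-sym e')) cycle-closed) λ ()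
    where
      u∉r : u ∉ᴸ verts G r
      u∉r u∈r with ∈-verts-++ʷ⁻ p (reverseʷ q) (r⊆ u∈r)
      ... | inj₁ u∈p = All.lookup u∉p u∈p refl
      ... | inj₂ u∈q = All.lookup u∉q (verts-reverseʷ⊆ q u∈q) refl
      cycle-closed : adj G b u ≡ false
      cycle-closed = acyclic u b (e ∷ r) (¬Any⇒All¬ (verts G r) u∉r ∷ r-path) (s≤s (≢⇒1≤len a≢b r))

  path : ∀ u v → Walk G u v
  path u v = proj₁ (toPath (connected u v))

  path-isPath : ∀ u v → IsPath G (path u v)
  path-isPath u v = proj₁ (proj₂ (toPath (connected u v)))

  isPath⇒≡path : (q : Walk G u v) → IsPath G q → q ≡ path u v
  isPath⇒≡path q q-path = paths-unique q _ q-path (path-isPath _ _)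

  dist : Fin n → Fin n → ℕ
  dist u v = len G (path u v)

  -- For an edge m y this says that z lies in the component of T − my containing y.
  InBranch : Fin n → Fin n → Fin n → Set
  InBranch m y z = dist m z ≡ suc (dist y z)

  inBranch? : ∀ m y z → Dec (InBranch m y z)
  inBranch? m y z = dist m z ≟ suc (dist y z)

  dist≤len : (q : Walk G u v) → dist u v ≤ len G q
  dist≤len q with toPath q
  ... | r , r-path , r≤q , _ = subst (λ t → len G t ≤ len G q) (isPath⇒≡path r r-path) r≤q

  Dist⇒≡dist : ∀ {k} → Dist G u v k → k ≡ dist u v
  Dist⇒≡dist ((p , refl) , minimal) = ≤-antisym (minimal (path _ _)) (dist≤len p)

  Dist-dist : ∀ u v → Dist G u v (dist u v)
  Dist-dist u v = (path u v , refl) , dist≤len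

  dist-triangle : ∀ u v w → dist u w ≤ dist u v + dist v w
  dist-triangle u v w = subst (dist u w ≤_) (len-++ʷ (path u v) (path v w)) (dist≤len (path u v ++ʷ path v w))

  dist-refl : ∀ u → dist u u ≡ 0
  dist-refl u = n≤0⇒n≡0 (dist≤len [])

  dist≡0⇒≡ : dist u v ≡ 0 → u ≡ v
  dist≡0⇒≡ {u} {v} = go (path u v)
    where
      go : (p : Walk G u v) → len G p ≡ 0 → u ≡ v
      go [] _ = refl

  dist-sym : ∀ u v → dist u v ≡ dist v u
  dist-sym u v = ≤-antisym (reversed u v) (reversed v u)
    where
      reversed : ∀ u v → dist u v ≤ dist v u
      reversed u v = subst (dist u v ≤_) (len-reverseʷ _) (dist≤len (reverseʷ (path v u)))

  ≢⇒1≤dist : u ≢ v → 1 ≤ dist u v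
  ≢⇒1≤dist u≢v = ≢⇒1≤len u≢v (path _ _)

  adj⇒dist≡1 : adj G u v ≡ true → dist u v ≡ 1
  adj⇒dist≡1 e = ≤-antisym (dist≤len (e ∷ [])) (≢⇒1≤dist (adj⇒≢ e))

  dist<len : (q : Walk G v w) → u ∈ᴸ verts G q → u ≢ v → dist u w < len G q
  dist<len []      (here refl) u≢u = ⊥-elim (u≢u refl)
  dist<len (e ∷ q) (here refl) u≢u = ⊥-elim (u≢u refl)
  dist<len (e ∷ q) (there u∈q) _   = let r , r≤q , _ = suffixFrom q u∈q in s≤s (≤-trans (dist≤len r) r≤q)

  ∉path⇒path≡∷ : (e : adj G u v ≡ true) → u ∉ᴸ verts G (path v w) → path u w ≡ e ∷ path v w
  ∉path⇒path≡∷ e u∉ = sym (isPath⇒≡path (e ∷ path _ _) (¬Any⇒All¬ (verts G (path _ _)) u∉ ∷ path-isPath _ _))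

  farther⇒path≡∷ : (e : adj G u v ≡ true) → InBranch u v w → path u w ≡ e ∷ path v w
  farther⇒path≡∷ e u-farther = ∉path⇒path≡∷ e λ u∈ →
    <⇒≱ (dist<len (path _ _) u∈ (adj⇒≢ e)) (subst (_ ≤_) (sym u-farther) (n≤1+n _))

  adj⇒branch-dichotomy : adj G u v ≡ true → ∀ w → InBranch u v w ⊎ InBranch v u w
  adj⇒branch-dichotomy {u} {v} e w with u ∈ᴸ? verts G (path v w)
  ... | yes u∈ = inj₂ (≤-antisym (dist≤len (adj-sym e ∷ path u w)) (dist<len (path v w) u∈ (adj⇒≢ e)))
  ... | no  u∉ = inj₁ (cong (len G) (∉path⇒path≡∷ e u∉))

  adj⇒dist-step : adj G u v ≡ true → ∀ w → dist w u ≡ suc (dist w v) ⊎ dist w v ≡ suc (dist w u)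
  adj⇒dist-step {u} {v} e w rewrite dist-sym w u | dist-sym w v = adj⇒branch-dichotomy e w

  toward : ∀ u v → u ≢ v → ∃[ y ] adj G u y ≡ true × InBranch u y v
  toward u v u≢v = first-step (path u v) refl
    where
      first-step : (q : Walk G u v) → len G q ≡ dist u v → ∃[ y ] adj G u y ≡ true × InBranch u y v
      first-step [] _ = ⊥-elim (u≢v refl)
      first-step (_∷_ {v = y} e q) q-shortest =
        y , e , ≤-antisym (dist≤len (e ∷ path y v)) (subst (suc (dist y v) ≤_) q-shortest (s≤s (dist≤len q)))

  toward-unique : adj G u y ≡ true → adj G u z ≡ true → InBranch u y v → InBranch u z v → y ≡ z
  toward-unique e e' y-closer z-closer =
    cong second (trans (sym (farther⇒path≡∷ e y-closer)) (farther⇒path≡∷ e' z-closer))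
    where
      second : Walk G u v → Fin n
      second {u} []                = u
      second (_∷_ {v = y} _ _) = y

  ∉branch⇒∈flipped : adj G m y ≡ true → ¬ InBranch m y z → InBranch y m z
  ∉branch⇒∈flipped {z = z} e z∉ with adj⇒branch-dichotomy e z
  ... | inj₁ z∈ = ⊥-elim (z∉ z∈)
  ... | inj₂ z-closer = z-closer

  ∈branch⇒∉flipped : InBranch m y z → ¬ InBranch y m z
  ∈branch⇒∉flipped {m} {y} {z} z∈ z∈' = m≢1+n+m (dist m z) {1} (trans z∈ (cong suc z∈'))

  hub∉branch : ¬ InBranch m y m
  hub∉branch {m} m∈ with trans (sym (dist-refl m)) m∈
  ... | ()

  leg∈branch : adj G m y ≡ true → InBranch m y y
  leg∈branch {y = y} e = trans (adj⇒dist≡1 e) (cong suc (sym (dist-refl y)))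

  branch-exit : adj G m y ≡ true → adj G z x ≡ true → InBranch m y z → ¬ InBranch m y x → z ≡ y × x ≡ m
  branch-exit {m} {y} {z} {x} e e' z∈ x∉ = ends (m ≟ᶠ x)
    where
      x-closer : dist y x ≡ suc (dist m x)
      x-closer = ∉branch⇒∈flipped e x∉

      off-by-one-twice : ∀ {a c} → suc a ≡ suc c ⊎ c ≡ suc (suc a) → a ≡ suc (suc c) ⊎ suc c ≡ suc a → c ≡ a
      off-by-one-twice     (inj₁ eq)   _         = sym (suc-injective eq)
      off-by-one-twice {a} (inj₂ refl) (inj₁ eq) = ⊥-elim (m≢1+n+m a eq)
      off-by-one-twice {a} (inj₂ refl) (inj₂ eq) = ⊥-elim (m≢1+n+m a (sym (suc-injective eq)))

      balanced : dist m x ≡ dist y z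
      balanced = off-by-one-twice
        (subst (λ d → d ≡ suc (dist m x) ⊎ dist m x ≡ suc d) z∈ (adj⇒dist-step e' m))
        (subst (λ d → dist y z ≡ suc d ⊎ d ≡ suc (dist y z)) x-closer (adj⇒dist-step e' y))

      ends : Dec (m ≡ x) → z ≡ y × x ≡ m
      ends (yes refl) = sym (dist≡0⇒≡ (trans (sym balanced) (dist-refl m))) , refl
      ends (no m≢x) with toward m x m≢x
      ... | b , eb , b-closer with adj⇒branch-dichotomy eb z
      ...   | inj₁ b-toward-z with toward-unique eb e b-toward-z z∈
      ...     | refl = ⊥-elim (m≢1+n+m (dist b x) {1} (trans x-closer (cong suc b-closer)))
      ends (no m≢x) | b , eb , b-closer | inj₂ b-farther =
        ⊥-elim (<⇒≱ x-detour (≤-trans (dist-triangle b x z) (≤-reflexive (cong (dist b x +_) (adj⇒dist≡1 (adj-sym e'))))))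
        where
          open ≤-Reasoning
          x-detour : dist b x + 1 < dist b z
          x-detour = begin-strict
            dist b x + 1   ≡⟨ +-comm (dist b x) 1 ⟩
            suc (dist b x) ≡⟨ b-closer ⟨
            dist m x       ≡⟨ balanced ⟩
            dist y z       <⟨ n<1+n _ ⟩
            suc (dist y z) ≡⟨ z∈ ⟨
            dist m z       <⟨ n<1+n _ ⟩
            suc (dist m z) ≡⟨ b-farther ⟨
            dist b z       ∎

  dist-across-branch : adj G m y ≡ true → InBranch m y z → ¬ InBranch m y w → dist z w ≡ dist z m + dist m w
  dist-across-branch {m} {y} {z} {w} e z∈ w∉ = go (dist z w) z∈ refl
    where
      go : ∀ k {z} → InBranch m y z → dist z w ≡ k → dist z w ≡ dist z m + dist m w
      go zero    z∈ zw≡0 = ⊥-elim (w∉ (subst (InBranch m y) (dist≡0⇒≡ zw≡0) z∈))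
      go (suc k) {z} z∈ zw≡1+k with toward z w (λ z≡w → w∉ (subst (InBranch m y) z≡w z∈))
      ... | z' , ez , z-farther with inBranch? m y z'
      ...   | no z'∉ with branch-exit e ez z∈ z'∉
      ...     | refl , refl = trans z-farther (cong (_+ dist m w) (sym (adj⇒dist≡1 (adj-sym e))))
      go (suc k) {z} z∈ zw≡1+k | z' , ez , z-farther | yes z'∈
        with adj⇒branch-dichotomy ez m | go k z'∈ (suc-injective (trans (sym z-farther) zw≡1+k))
      ... | inj₁ z-from-m | ih = begin
        dist z w                      ≡⟨ z-farther ⟩
        suc (dist z' w)               ≡⟨ cong suc ih ⟩
        suc (dist z' m + dist m w)    ≡⟨ cong (_+ dist m w) z-from-m ⟨
        dist z m + dist m w           ∎
        where open ≡-Reasoning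
      ... | inj₂ z'-from-m | ih = ⊥-elim (<⇒≱ detour (dist-triangle z m w))
        where
          detour : dist z m + dist m w < dist z w
          detour = begin-strict
            dist z m + dist m w               <⟨ n<1+n _ ⟩
            suc (dist z m + dist m w)         <⟨ n<1+n _ ⟩
            suc (suc (dist z m) + dist m w)   ≡⟨ cong (λ d → suc (d + dist m w)) z'-from-m ⟨
            suc (dist z' m + dist m w)        ≡⟨ cong suc ih ⟨
            suc (dist z' w)                   ≡⟨ z-farther ⟨
            dist z w                          ∎
            where open ≤-Reasoning

  branch-outward-closed : adj G m y ≡ true → InBranch m y z → adj G z x ≡ true → InBranch x z m → InBranch m y x
  branch-outward-closed {m} {y} {z} {x} e z∈ ezx x-outward with inBranch? m y x
  ... | yes x∈ = x∈
  ... | no x∉ with branch-exit e ezx z∈ x∉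
  ...   | refl , refl = ⊥-elim (hub∉branch x-outward)

  beyond-hub-farther : adj G c t ≡ true → ¬ InBranch c t m → InBranch c t z → dist c m < dist z m
  beyond-hub-farther {c} {m = m} {z} e m∉ z∈ =
    subst (dist c m <_) (sym (dist-across-branch e z∈ m∉)) (m<n+m (dist c m) (≢⇒1≤dist λ { refl → hub∉branch z∈ }))

  branch-nested : adj G m y ≡ true → adj G c t ≡ true → InBranch m y c → ¬ InBranch c t m →
                  InBranch c t z → InBranch m y z
  branch-nested {m} {y} {c} {t} {z} e e' c∈ m∉ z∈ with inBranch? m y z
  ... | yes z∈' = z∈'
  ... | no z∉ = ⊥-elim (hub∉branch (subst (InBranch m y) (dist≡0⇒≡ cm≡0) c∈))
    where
      open ≡-Reasoning
      a≡b+[a+b]⇒b≡0 : ∀ a b → a ≡ b + (a + b) → b ≡ 0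
      a≡b+[a+b]⇒b≡0 a zero    _  = refl
      a≡b+[a+b]⇒b≡0 a (suc b) eq = ⊥-elim (m+1+n≰m a (subst (a + suc b ≤_) (sym eq) (m≤n+m (a + suc b) (suc b))))
      cm≡0 : dist c m ≡ 0
      cm≡0 = a≡b+[a+b]⇒b≡0 (dist c z) (dist c m) (begin
        dist c z                          ≡⟨ dist-across-branch e c∈ z∉ ⟩
        dist c m + dist m z               ≡⟨ cong (dist c m +_) (dist-sym m z) ⟩
        dist c m + dist z m               ≡⟨ cong (dist c m +_) (dist-across-branch e' z∈ m∉) ⟩
        dist c m + (dist z c + dist c m)  ≡⟨ cong (λ d → dist c m + (d + dist c m)) (dist-sym z c) ⟩
        dist c m + (dist c z + dist c m)  ∎)

  InBranch-by-dist : adj G u v ≡ true → InBranch u v x → dist x w ≤ dist u w → InBranch u v w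
  InBranch-by-dist {u} {v} {x} {w} e x∈ xw≤uw with inBranch? u v w
  ... | yes w∈ = w∈
  ... | no w∉ = ⊥-elim (<⇒≱ (subst (dist u w <_) (sym (dist-across-branch e x∈ w∉)) u-nearer) xw≤uw)
    where
      u-nearer : dist u w < dist x u + dist u w
      u-nearer = m<n+m (dist u w) (≢⇒1≤dist λ { refl → hub∉branch x∈ })

  record Fork (Q : Pred (Fin n) 0ℓ) : Set where
    constructor fork
    field
      {hub leg₁ leg₂} : Fin n
      hub-leg₁  : adj G hub leg₁ ≡ true
      hub-leg₂  : adj G hub leg₂ ≡ true
      leg₁≢leg₂ : leg₁ ≢ leg₂
      avoids₁   : ∀ {w} → Q w → ¬ InBranch hub leg₁ w
      avoids₂   : ∀ {w} → Q w → ¬ InBranch hub leg₂ w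

  -- u and x walk toward each other; they meet at the midpoint of the u–x path, which is the hub.
  equidistant⇒fork : ∀ {Q : Pred (Fin n) 0ℓ} {w₀} → Q w₀ → u ≢ x → (∀ {w} → Q w → dist u w ≡ dist x w) → Fork Q
  equidistant⇒fork {u} {x} {Q} {w₀} w₀∈Q = go (dist u x) ≤-refl
    where
      go : ∀ k {u x} → dist u x ≤ k → u ≢ x → (∀ {w} → Q w → dist u w ≡ dist x w) → Fork Q
      go zero    ux≤0 u≢x _ = ⊥-elim (u≢x (dist≡0⇒≡ (n≤0⇒n≡0 ux≤0)))
      go (suc k) {u} {x} ux≤1+k u≢x equidistant with toward u x u≢x
      ... | u' , eu , u'-toward-x with u' ≟ᶠ x
      ...   | yes refl with adj⇒branch-dichotomy eu w₀
      ...     | inj₁ far = ⊥-elim (m≢1+n+m (dist u' w₀) {0} (trans (sym (equidistant w₀∈Q)) far))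
      ...     | inj₂ far = ⊥-elim (m≢1+n+m (dist u w₀) {0} (trans (equidistant w₀∈Q) far))
      go (suc k) {u} {x} ux≤1+k u≢x equidistant | u' , eu , u'-toward-x | no u'≢x
        with toward x u' (u'≢x ∘ sym)
      ... | x' , ex , x'-toward-u' with x' ≟ᶠ u'
      ...   | yes refl = fork (adj-sym eu) (adj-sym ex) u≢x
                           (λ w∈Q w∈ → u≢x (legs-agree w∈ (trans w∈ (cong suc (equidistant w∈Q)))))
                           (λ w∈Q w∈ → u≢x (legs-agree (trans w∈ (cong suc (sym (equidistant w∈Q)))) w∈))
        where
          legs-agree : ∀ {w} → InBranch x' u w → InBranch x' x w → u ≡ x
          legs-agree = toward-unique (adj-sym eu) (adj-sym ex)
      ...   | no x'≢u' = go k u'x'≤k (x'≢u' ∘ sym) equidistant'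
        where
          ux≡2+u'x' : dist u x ≡ suc (suc (dist u' x'))
          ux≡2+u'x' = trans u'-toward-x (cong suc (trans (dist-sym u' x) (trans x'-toward-u' (cong suc (dist-sym x' u')))))
          u'x'≤k : dist u' x' ≤ k
          u'x'≤k = ≤-trans (n≤1+n _) (≤-pred (subst (_≤ suc k) ux≡2+u'x' ux≤1+k))
          u-step : ∀ {w} → Q w → dist u w ≡ suc (dist u' w)
          u-step w∈Q = InBranch-by-dist eu u'-toward-x (≤-reflexive (sym (equidistant w∈Q)))
          x-step : ∀ {w} → Q w → dist x w ≡ suc (dist x' w)
          x-step w∈Q = InBranch-by-dist ex x'-toward-u'
            (≤-trans (n≤1+n _) (≤-reflexive (trans (sym (u-step w∈Q)) (equidistant w∈Q))))
          equidistant' : ∀ {w} → Q w → dist u' w ≡ dist x' w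
          equidistant' w∈Q = suc-injective (trans (sym (u-step w∈Q)) (trans (equidistant w∈Q) (x-step w∈Q)))

  neighbours : Fin n → List (Fin n)
  neighbours v = filter (λ w → adj G v w Bool.≟ true) (allFin n)

  ∈-neighbours⁺ : adj G v w ≡ true → w ∈ᴸ neighbours v
  ∈-neighbours⁺ {v} e = ∈-filter⁺ (λ w → adj G v w Bool.≟ true) (∈-allFin _) e

  ∈-neighbours⁻ : w ∈ᴸ neighbours v → adj G v w ≡ true
  ∈-neighbours⁻ {v = v} w∈ = proj₂ (∈-filter⁻ (λ w → adj G v w Bool.≟ true) {xs = allFin n} w∈)

  neighbours-unique : ∀ v → Unique (neighbours v)
  neighbours-unique v = Uniqueₚ.filter⁺ (λ w → adj G v w Bool.≟ true) (Uniqueₚ.allFin⁺ n)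

  three-neighbours⇒Major : adj G v a ≡ true → adj G v b ≡ true → adj G v c ≡ true →
                           a ≢ b → a ≢ c → b ≢ c → Major G v
  three-neighbours⇒Major ea eb ec = 3≤length (∈-neighbours⁺ ea) (∈-neighbours⁺ eb) (∈-neighbours⁺ ec)

  Major⇒outward-neighbour : Major G c → ∀ m → ∃[ t ] adj G c t ≡ true × InBranch t c m
  Major⇒outward-neighbour {c} c-major m
    with unique∧2≤length⇒distinct (neighbours-unique c) (≤-trans (n≤1+n 2) c-major)
  ... | t₁ , t₂ , t₁∈ , t₂∈ , t₁≢t₂
    with adj⇒branch-dichotomy (∈-neighbours⁻ t₁∈) m | adj⇒branch-dichotomy (∈-neighbours⁻ t₂∈) m
  ...   | inj₁ t₁-closer | inj₁ t₂-closer =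
          ⊥-elim (t₁≢t₂ (toward-unique (∈-neighbours⁻ t₁∈) (∈-neighbours⁻ t₂∈) t₁-closer t₂-closer))
  ...   | inj₂ t₁-outward | _ = t₁ , ∈-neighbours⁻ t₁∈ , t₁-outward
  ...   | inj₁ _ | inj₂ t₂-outward = t₂ , ∈-neighbours⁻ t₂∈ , t₂-outward

  unique-neighbour⇒Leaf : adj G v a ≡ true → (∀ {w} → adj G v w ≡ true → w ≡ a) → Leaf G v
  unique-neighbour⇒Leaf {v} ea only-a =
    unique∧constant⇒length≡1 (neighbours-unique v) (∈-neighbours⁺ ea) (only-a ∘ ∈-neighbours⁻)

  Leaf⇒neighbours-equal : Leaf G v → adj G v a ≡ true → adj G v b ≡ true → a ≡ b
  Leaf⇒neighbours-equal {v} {a} {b} v-leaf ea eb with a ≟ᶠ b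
  ... | yes a≡b = a≡b
  ... | no a≢b  = ⊥-elim (1+n≰n (subst (2 ≤_) v-leaf (2≤length (∈-neighbours⁺ ea) (∈-neighbours⁺ eb) a≢b)))

  outward-closed⇒leaf : ∀ {X : Pred (Fin n) 0ℓ} → Decidable X → ¬ X c →
    (∀ {z x} → X z → adj G z x ≡ true → InBranch x z c → X x) → X z → ∃[ ℓ ] X ℓ × Leaf G ℓ
  outward-closed⇒leaf {c} {X = X} X? c∉X outward-closed z∈X with farthest X? (dist c) z∈X
  ... | ℓ , ℓ∈X , ℓ-farthest with toward ℓ c (λ { refl → c∉X ℓ∈X })
  ...   | p , ep , p-toward-c = ℓ , ℓ∈X , unique-neighbour⇒Leaf ep only-p
    where
      only-p : ∀ {w} → adj G ℓ w ≡ true → w ≡ p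
      only-p {w} e with adj⇒branch-dichotomy e c
      ... | inj₁ w-toward-c = toward-unique e ep w-toward-c p-toward-c
      ... | inj₂ w-outward = ⊥-elim (1+n≰n (subst (_≤ dist c ℓ) cw≡1+cℓ (ℓ-farthest (outward-closed ℓ∈X e w-outward))))
        where
          cw≡1+cℓ : dist c w ≡ suc (dist c ℓ)
          cw≡1+cℓ = trans (dist-sym c w) (trans w-outward (cong suc (dist-sym ℓ c)))

  bare-branch⇒ExteriorMajor : adj G c y ≡ true → Major G c → (∀ {z} → InBranch c y z → ¬ Major G z) →
                              ExteriorMajor G c
  bare-branch⇒ExteriorMajor {c} {y} e c-major bare
    with outward-closed⇒leaf (inBranch? c y) hub∉branch (branch-outward-closed e) (leg∈branch e)
  ... | ℓ , ℓ∈ , ℓ-leaf = c-major , ℓ , ℓ-leaf , c-major , nearest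
    where
      nearest : ∀ w → Major G w → w ≢ c → ∀ k l → Dist G ℓ c k → Dist G ℓ w l → k < l
      nearest w w-major w≢c k l ℓc≡k ℓw≡l rewrite Dist⇒≡dist ℓc≡k | Dist⇒≡dist ℓw≡l =
        subst (dist ℓ c <_) (sym (dist-across-branch e ℓ∈ λ w∈ → bare w∈ w-major))
          (m<m+n (dist ℓ c) (≢⇒1≤dist (w≢c ∘ sym)))

  SameRep⇒equidistant : ∀ {W} → SameRep G W u x → ∀ {w} → w ∈ W → dist u w ≡ dist x w
  SameRep⇒equidistant {u} sr {w} w∈W = Dist⇒≡dist (Equivalence.to (sr w w∈W (dist u w)) (Dist-dist u w))

  fork-free⇒Resolving : ∀ {W w₀} → w₀ ∈ W → ¬ Fork (_∈ W) → Resolving G W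
  fork-free⇒Resolving w₀∈W no-fork u x sr with u ≟ᶠ x
  ... | yes u≡x = u≡x
  ... | no u≢x  = ⊥-elim (no-fork (equidistant⇒fork w₀∈W u≢x (SameRep⇒equidistant sr)))

  trivial⇒Resolving : (∀ u v → u ≡ v) → ∀ W → Resolving G W
  trivial⇒Resolving all-equal W u v _ = all-equal u v

  ∃-leaf : u ≢ v → ∃[ ℓ ] Leaf G ℓ
  ∃-leaf {u} {v} u≢v =
    let ℓ , _ , ℓ-leaf = outward-closed⇒leaf (λ t → ¬? (t ≟ᶠ v)) (λ v≢v → v≢v refl)
                           (λ { _ _ x-outward refl → hub∉branch x-outward }) u≢v
    in ℓ , ℓ-leaf

  no-major⇒leaf-resolves : (∀ v → ¬ Major G v) → Leaf G ℓ → Resolving G ⁅ ℓ ⁆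
  no-major⇒leaf-resolves {ℓ} no-major ℓ-leaf = fork-free⇒Resolving (x∈⁅x⁆ ℓ) no-fork
    where
      no-fork : ¬ Fork (_∈ ⁅ ℓ ⁆)
      no-fork (fork {m} {y₁} {y₂} e₁ e₂ y₁≢y₂ avoids₁ avoids₂) with ℓ ≟ᶠ m
      ... | yes refl = y₁≢y₂ (Leaf⇒neighbours-equal ℓ-leaf e₁ e₂)
      ... | no ℓ≢m with toward m ℓ (ℓ≢m ∘ sym)
      ...   | y₃ , e₃ , ℓ∈ = no-major m (three-neighbours⇒Major e₁ e₂ e₃ y₁≢y₂
                (λ { refl → avoids₁ (x∈⁅x⁆ ℓ) ℓ∈ }) (λ { refl → avoids₂ (x∈⁅x⁆ ℓ) ℓ∈ }))

  module Signed (σ : Signature G) where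
    sign : Fin n → Fin n → Sign
    sign u w = pathSign G σ (path u w)

    sdist : Fin n → Fin n → ℤ
    sdist u w = sign u w ◃ dist u w

    SignedDist⇒≡sdist : ∀ {k} → SignedDist G σ u w k → k ≡ sdist u w
    SignedDist⇒≡sdist (p , p-path , refl) rewrite isPath⇒≡path p p-path = refl

    SignedDist-sdist : ∀ u w → SignedDist G σ u w (sdist u w)
    SignedDist-sdist u w = path u w , path-isPath u w , refl

    sign-step : adj G u v ≡ true → InBranch u v w → sign u w ≡ sgn σ u v *ₛ sign v w
    sign-step e u-farther = cong (pathSign G σ) (farther⇒path≡∷ e u-farther)

    equal-sdist⇒SameRepΣ : ∀ {W} → (∀ {w} → w ∈ W → sdist u w ≡ sdist x w) → SameRepΣ G σ W u x
    equal-sdist⇒SameRepΣ {u} {x} same w w∈W =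
      same-unique-value⇒⇔ SignedDist⇒≡sdist (SignedDist-sdist u w) SignedDist⇒≡sdist (SignedDist-sdist x w) (same w∈W)

    SameRepΣ⇒equidistant : ∀ {W} → SameRepΣ G σ W u x → ∀ {w} → w ∈ W → dist u w ≡ dist x w
    SameRepΣ⇒equidistant {u} {x} sr {w} w∈W = begin
      dist u w              ≡⟨ abs-◃ (sign u w) (dist u w) ⟨
      ℤ.∣ sdist u w ∣        ≡⟨ cong ℤ.∣_∣ (SignedDist⇒≡sdist (Equivalence.to (sr w w∈W _) (SignedDist-sdist u w))) ⟩
      ℤ.∣ sdist x w ∣        ≡⟨ abs-◃ (sign x w) (dist x w) ⟩
      dist x w              ∎
      where open ≡-Reasoning

    Resolving⇒ResolvingΣ : ∀ {W} → Resolving G W → ResolvingΣ G σ W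
    Resolving⇒ResolvingΣ resolves u x sr = resolves u x λ w w∈W →
      same-unique-value⇒⇔ Dist⇒≡dist (Dist-dist u w) Dist⇒≡dist (Dist-dist x w) (SameRepΣ⇒equidistant sr w∈W)

  Avoids : Subset n → Fin n → Fin n → Set
  Avoids W m y = ∀ {w} → w ∈ W → ¬ InBranch m y w

  module LowerBound (σ : Signature G) {Wσ : Subset n} (resolvesΣ : ResolvingΣ G σ Wσ) where
    open Signed σ

    sdist-via-hub : adj G m y ≡ true → ¬ InBranch m y w → sdist y w ≡ (sgn σ y m *ₛ sign m w) ◃ suc (dist m w)
    sdist-via-hub e w∉ = cong₂ _◃_ (sign-step (adj-sym e) y-farther) y-farther
      where y-farther = ∉branch⇒∈flipped e w∉

    equal-signs⇒equal-legs : adj G m a ≡ true → adj G m b ≡ true → Avoids Wσ m a → Avoids Wσ m b →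
                             sgn σ a m ≡ sgn σ b m → a ≡ b
    equal-signs⇒equal-legs {m} {a} {b} ea eb a-avoids b-avoids same-sign =
      resolvesΣ a b (equal-sdist⇒SameRepΣ λ {w} w∈Wσ → begin
        sdist a w                                ≡⟨ sdist-via-hub ea (a-avoids w∈Wσ) ⟩
        (sgn σ a m *ₛ sign m w) ◃ suc (dist m w) ≡⟨ cong (λ s → (s *ₛ sign m w) ◃ suc (dist m w)) same-sign ⟩
        (sgn σ b m *ₛ sign m w) ◃ suc (dist m w) ≡⟨ sdist-via-hub eb (b-avoids w∈Wσ) ⟨
        sdist b w                                ∎)
      where open ≡-Reasoning

    no-three-avoiding-legs : adj G m a ≡ true → adj G m b ≡ true → adj G m c ≡ true →
      Avoids Wσ m a → Avoids Wσ m b → Avoids Wσ m c → a ≢ b → a ≢ c → b ≢ c → ⊥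
    no-three-avoiding-legs {m} {a} {b} {c} ea eb ec a-av b-av c-av a≢b a≢c b≢c
      with two-of-three-signs-equal (sgn σ a m) (sgn σ b m) (sgn σ c m)
    ... | inj₁ ab        = a≢b (equal-signs⇒equal-legs ea eb a-av b-av ab)
    ... | inj₂ (inj₁ ac) = a≢c (equal-signs⇒equal-legs ea ec a-av c-av ac)
    ... | inj₂ (inj₂ bc) = b≢c (equal-signs⇒equal-legs eb ec b-av c-av bc)

    BareLeg : Fin n → Fin n → Set
    BareLeg c y = adj G c y ≡ true × (∀ z → InBranch c y z → ¬ Major G z × z ∉ Wσ)

    bareLeg? : ∀ c y → Dec (BareLeg c y)
    bareLeg? c y = (adj G c y Bool.≟ true)
      ×-dec Finₚ.all? (λ z → inBranch? c y z →-dec (¬? (3 ≤? degree G z) ×-dec ¬? (z ∈? Wσ)))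

    -- The junk value c is returned when c has no bare leg.
    leg : Fin n → Fin n
    leg c with Finₚ.any? (bareLeg? c)
    ... | yes (y , _) = y
    ... | no _        = c

    leg-bare : BareLeg c y → BareLeg c (leg c)
    leg-bare {c} {y} bare with Finₚ.any? (bareLeg? c)
    ... | yes (_ , bare') = bare'
    ... | no no-bare      = ⊥-elim (no-bare (y , bare))

    module _ (S : Subset n) (S-exterior : ∀ v → v ∈ S ⇔ ExteriorMajor G v) where

      W : Subset n
      W = Wσ ∪ image leg S

      ∣W∣≤ : ∣ W ∣ ≤ ∣ Wσ ∣ + ∣ S ∣
      ∣W∣≤ = ≤-trans (∣p∪q∣≤∣p∣+∣q∣ Wσ (image leg S)) (+-monoʳ-≤ ∣ Wσ ∣ (∣image∣≤ leg S))

      Wσ⊆W : w ∈ Wσ → w ∈ W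
      Wσ⊆W w∈ = x∈p∪q⁺ (inj₁ w∈)

      bare-exterior-leg : BareLeg c y → Major G c → BareLeg c (leg c) × leg c ∈ W
      bare-exterior-leg {c} {y} (e , bare) c-major =
        leg-bare (e , bare) ,
        x∈p∪q⁺ (inj₂ (∈-image leg (Equivalence.from (S-exterior c)
          (bare-branch⇒ExteriorMajor e c-major (λ {z} z∈ → proj₁ (bare z z∈))))))

      farthest-major⇒bare-leg : adj G m y ≡ true → Avoids W m y → InBranch m y c → Major G c →
        (∀ {z} → InBranch m y z × Major G z → dist z m ≤ dist c m) → ∃[ t ] BareLeg c t
      farthest-major⇒bare-leg {m} {y} {c} e avoids c∈ c-major c-farthest with Major⇒outward-neighbour c-major m
      ... | t , et , t-outward = t , et , λ z z∈ct →
              let z∈my = branch-nested e et c∈ m∉ z∈ct in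
              (λ z-major → <⇒≱ (beyond-hub-farther et m∉ z∈ct) (c-farthest (z∈my , z-major))) ,
              (λ z∈Wσ → avoids (Wσ⊆W z∈Wσ) z∈my)
        where
          m∉ : ¬ InBranch c t m
          m∉ = ∈branch⇒∉flipped t-outward

      avoiding-branch⇒no-leg-in-W : w₀ ∈ Wσ → adj G m y ≡ true → Avoids W m y → InBranch m y c →
                                    BareLeg c p → p ∈ W → ⊥
      avoiding-branch⇒no-leg-in-W {w₀} {m} {c = c} w₀∈ e avoids c∈ (ep , p-bare) p∈W with adj⇒branch-dichotomy ep m
      ... | inj₂ p-outward = avoids p∈W (branch-nested e ep c∈ (∈branch⇒∉flipped p-outward) (leg∈branch ep))
      ... | inj₁ p-toward-m = proj₂ (p-bare w₀ (InBranch-by-dist ep p-toward-m m-between)) w₀∈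
        where
          m-between : dist m w₀ ≤ dist c w₀
          m-between = subst (dist m w₀ ≤_) (sym (dist-across-branch e c∈ (avoids (Wσ⊆W w₀∈))))
                        (m≤n+m (dist m w₀) (dist c m))

      avoiding-branch-bare : w₀ ∈ Wσ → adj G m y ≡ true → Avoids W m y → InBranch m y z → ¬ Major G z
      avoiding-branch-bare {m = m} {y} w₀∈ e avoids z∈ z-major =
        let c , (c∈ , c-major) , c-farthest =
              farthest (λ z → inBranch? m y z ×-dec (3 ≤? degree G z)) (λ z → dist z m) (z∈ , z-major)
            t , t-bare = farthest-major⇒bare-leg e avoids c∈ c-major c-farthest
            p-bare , p∈W = bare-exterior-leg t-bare c-major
        in avoiding-branch⇒no-leg-in-W w₀∈ e avoids c∈ p-bare p∈W

      W-resolving : w₀ ∈ Wσ → Major G M → Resolving G W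
      W-resolving {w₀} {M} w₀∈ M-major = fork-free⇒Resolving (Wσ⊆W w₀∈) no-fork
        where
          no-fork : ¬ Fork (_∈ W)
          no-fork (fork {m} {y₁} {y₂} e₁ e₂ y₁≢y₂ avoids₁ avoids₂) with 3 ≤? degree G m
          ... | yes m-major =
                  let (ep , p-bare) , p∈W = bare-exterior-leg bare₁ m-major in
                  no-three-avoiding-legs e₁ e₂ ep (avoids₁ ∘ Wσ⊆W) (avoids₂ ∘ Wσ⊆W) (λ w∈Wσ w∈ → proj₂ (p-bare _ w∈) w∈Wσ)
                    y₁≢y₂ (λ { refl → avoids₁ p∈W (leg∈branch e₁) }) (λ { refl → avoids₂ p∈W (leg∈branch e₂) })
            where
              bare₁ : BareLeg m y₁
              bare₁ = e₁ , λ z z∈ → avoiding-branch-bare w₀∈ e₁ avoids₁ z∈ , λ z∈Wσ → avoids₁ (Wσ⊆W z∈Wσ) z∈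
          ... | no m-minor with toward m M (λ { refl → m-minor M-major })
          ...   | y₃ , e₃ , M∈ = m-minor (three-neighbours⇒Major e₁ e₂ e₃ y₁≢y₂
                    (λ { refl → avoiding-branch-bare w₀∈ e₁ avoids₁ M∈ M-major })
                    (λ { refl → avoiding-branch-bare w₀∈ e₂ avoids₂ M∈ M-major }))

      ∃-resolving-of-size≤ : ∃[ W' ] Resolving G W' × ∣ W' ∣ ≤ ∣ Wσ ∣ + ∣ S ∣
      ∃-resolving-of-size≤ with Finₚ.any? (_∈? Wσ)
      ... | no Wσ-empty =
            Wσ , trivial⇒Resolving (λ u v → resolvesΣ u v λ w w∈ → ⊥-elim (Wσ-empty (w , w∈))) Wσ , m≤m+n _ _
      ... | yes (w₀ , w₀∈) with Finₚ.any? (λ v → 3 ≤? degree G v)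
      ...   | yes (M , M-major) = W , W-resolving w₀∈ M-major , ∣W∣≤
      ...   | no no-major with Finₚ.all? (_≟ᶠ w₀)
      ...     | yes all-w₀ = Wσ , trivial⇒Resolving (λ u v → trans (all-w₀ u) (sym (all-w₀ v))) Wσ , m≤m+n _ _
      ...     | no not-all-w₀ =
                let u , u≢w₀ = Finₚ.¬∀⟶∃¬ n (_≡ w₀) (_≟ᶠ w₀) not-all-w₀
                    ℓ , ℓ-leaf = ∃-leaf u≢w₀
                in ⁅ ℓ ⁆ , no-major⇒leaf-resolves (λ v v-major → no-major (v , v-major)) ℓ-leaf ,
                   ≤-trans (≤-reflexive (∣⁅x⁆∣≡1 ℓ)) (≤-trans (x∈p⇒1≤∣p∣ w₀∈) (m≤m+n _ _))

theorem4p4 : ∀ {n : ℕ} (T : Graph n) → IsTree T → (σ : Signature T) →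
    ∀ (d dσ e : ℕ) → IsMetricDim T d → IsSignedMetricDim T σ dσ → IsExt T e →
    (d ≤ dσ + e) × (dσ ≤ d)
theorem4p4 T tree σ d dσ e
  ((W , resolves , ∣W∣≡d) , d-minimal) ((Wσ , resolvesΣ , ∣Wσ∣≡dσ) , dσ-minimal) (S , ∣S∣≡e , S-exterior) =
  lower , upper
  where
    open Tree T tree
    upper : dσ ≤ d
    upper = subst (dσ ≤_) ∣W∣≡d (dσ-minimal W (Signed.Resolving⇒ResolvingΣ σ resolves))
    lower : d ≤ dσ + e
    lower = let W' , resolves' , ∣W'∣≤ = LowerBound.∃-resolving-of-size≤ σ resolvesΣ S S-exterior in
      ≤-trans (d-minimal W' resolves') (subst₂ (λ a b → ∣ W' ∣ ≤ a + b) ∣Wσ∣≡dσ ∣S∣≡e ∣W'∣≤)
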